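{- With $K$, $P$, $wAI(P)$, $\equiv$ and the operations on classes as in the context, the structure $(wAI(P)/\equiv,\oplus,\otimes,\overline{0},\overline{1})$ is a commutative and idempotent semiring.
   Context: $(K,\oplus,\otimes,\hat0,\hat1)$ is a commutative and additively idempotent semiring. $P$ is a finite nonempty set of ports with $0,1\notin P$, each $p\in P$ having a fixed weight $k_p\in K$. $\Gamma(P)=2^{2^P}$. The terms of the weighted Algebra of Interactions $wAI(P)$ are generated by $z::=0\mid 1\mid p\mid z\oplus z\mid z\otimes z\mid (z)$, $p\in P$. Semantics: for $\gamma\in\Gamma(P)$, $\|0\|(\gamma)=\hat0$; $\|1\|(\gamma)=\hat1$ if $\emptyset\in\gamma$, else $\hat0$; $\|p\|(\gamma)=k_p$ if some $a\in\gamma$ contains $p$, else $\hat0$; $\|z_1\oplus z_2\|(\gamma)=\bigoplus_{a\in\gamma}(\|z_1\|(\{a\})\oplus\|z_2\|(\{a\}))$; $\|z_1\otimes z_2\|(\gamma)=\bigoplus_{a\in\gamma}\bigoplus_{a=a_1\cup a_2}(\|z_1\|(\{a_1\})\otimes\|z_2\|(\{a_2\}))$, the inner sum over all pairs of (possibly empty) subsets $a_1,a_2\subseteq P$ with $a_1\cup a_2=a$; $\|(z)\|(\gamma)=\|z\|(\gamma)$; empty sums are $\hat0$. $z_1\equiv z_2$ iff $\|z_1\|(\gamma)=\|z_2\|(\gamma)$ for all $\gamma\in\Gamma(P)$; $\overline{z}$ is the class of $z$, and $\overline{z_1}\oplus\overline{z_2}=\overline{z_1\oplus z_2}$, $\overline{z_1}\otimes\overline{z_2}=\overline{z_1\otimes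 z_2}$ (well defined). -}

module Defs where

open import Level using (_⊔_)
open import Data.Nat using (ℕ; zero; suc)
open import Data.Bool using (Bool; true; false; if_then_else_)
open import Data.Fin using (Fin)
open import Data.Fin.Subset using (Subset; _∪_; _∈_)
open import Data.Fin.Subset.Properties using (_∈?_)
open import Data.Vec using (Vec; []; _∷_)
open import Data.Vec.Properties using (≡-dec)
open import Data.List using (List; []; _∷_; map; _++_; foldr)
open import Data.Product using (∃)
import Data.Bool.Properties as BoolP
open import Relation.Nullary using (does)
open import Algebra.Bundles using (CommutativeSemiring)

allSubsets : (n : ℕ) → List (Subset n)
allSubsets zero = [] ∷ []
allSubsets (suc n) = map (true ∷_) (allSubsets n) ++ map (false ∷_) (allSubsets n)

_=ˢ_ : ∀ {n} → Subset n → Subset n → Bool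
a =ˢ b = does (≡-dec BoolP._≟_ a b)

contains : ∀ {n} → Fin n → Subset n → Bool
contains p a = does (p ∈? a)

-- Terms of wAI(P), with P = Fin n.
data Term (n : ℕ) : Set where
  𝟘 𝟙 : Term n
  port : Fin n → Term n
  _⊕_ _⊗_ : Term n → Term n → Term n

-- Γ(P) = 2^(2^P): a set of subsets of P, given by its (decidable) membership predicate.
Γ : ℕ → Set
Γ n = Subset n → Bool

module WAI {c ℓ} (K : CommutativeSemiring c ℓ) (n : ℕ) (k : Fin n → CommutativeSemiring.Carrier K) where
  open CommutativeSemiring K renaming (Carrier to A)

  ⨁ : List A → A
  ⨁ = foldr _+_ 0#

  sumγ : Γ n → (Subset n → A) → A
  sumγ γ f = ⨁ (map (λ a → if γ a then f a else 0#) (allSubsets n))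

  sumSplit : Subset n → (Subset n → Subset n → A) → A
  sumSplit a f = ⨁ (map (λ a₁ → ⨁ (map (λ a₂ → if (a₁ ∪ a₂) =ˢ a then f a₁ a₂ else 0#)
                                       (allSubsets n)))
                        (allSubsets n))

  ⟪_⟫ : Subset n → Γ n
  ⟪ a ⟫ b = a =ˢ b

  anyγ : Γ n → (Subset n → Bool) → Bool
  anyγ γ q = foldr (λ a r → (γ a Data.Bool.∧ q a) Data.Bool.∨ r) false (allSubsets n)

  ∅ : Subset n
  ∅ = Data.Vec.replicate n false

  ⟦_⟧ : Term n → Γ n → A
  ⟦ 𝟘 ⟧ γ = 0#
  ⟦ 𝟙 ⟧ γ = if γ ∅ then 1# else 0#
  ⟦ port p ⟧ γ = if anyγ γ (contains p) then k p else 0#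
  ⟦ z₁ ⊕ z₂ ⟧ γ = sumγ γ (λ a → ⟦ z₁ ⟧ ⟪ a ⟫ + ⟦ z₂ ⟧ ⟪ a ⟫)
  ⟦ z₁ ⊗ z₂ ⟧ γ = sumγ γ (λ a → sumSplit a (λ a₁ a₂ → ⟦ z₁ ⟧ ⟪ a₁ ⟫ * ⟦ z₂ ⟧ ⟪ a₂ ⟫))

  _≋_ : Term n → Term n → Set ℓ
  z₁ ≋ z₂ = ∀ (γ : Γ n) → ⟦ z₁ ⟧ γ ≈ ⟦ z₂ ⟧ γ

{-# OPTIONS --safe #-}
module Submission where

-- Evaluated on a singleton {a}, a term z gives its profile  a ↦ ‖z‖({a}), and
-- ‖z‖(γ) = ⨁_{a ∈ γ} ‖z‖({a})  (for ports this uses idempotence of ⊕).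
-- So two terms are equivalent iff their profiles agree, ⊕ becomes the pointwise sum
-- of profiles and ⊗ their convolution along ∪.  The profiles, with pointwise sum and
-- convolution, form a commutative idempotent semiring (the semigroup algebra of
-- (2^P, ∪) over K), and the laws transfer to terms.

open import Algebra.Bundles using (CommutativeSemiring)
open import Algebra.Definitions using (Idempotent)
open import Algebra.Structures using (IsMagma; IsCommutativeSemiring)
open import Algebra.Structures.Biased using (isCommutativeMonoidˡ; isCommutativeSemiringˡ)
open import Data.Bool using (Bool; true; false; if_then_else_; _∧_; _∨_)
open import Data.Bool.ListAction using (any)
import Data.Bool.Properties as Bool
open import Data.Fin using (Fin)
open import Data.Fin.Subset using (Subset; _∪_)
open import Data.Fin.Subset.Properties using (∪-comm; ∪-assoc; ∪-identityˡ)
open import Data.List using (List; []; _∷_; map; foldr)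
open import Data.List.Membership.Propositional using (_∈_)
open import Data.List.Membership.Propositional.Properties using (∈-++⁺ˡ; ∈-++⁺ʳ; ∈-map⁺)
open import Data.List.Properties using (foldr-map)
open import Data.List.Relation.Unary.Any as Any using (here)
open import Data.List.Relation.Unary.Any.Properties using (any⁺)
open import Data.Nat using (ℕ; suc)
open import Data.Product using (_×_; _,_)
open import Data.Vec using ([]; _∷_)
open import Data.Vec.Properties using (≡-dec)
open import Function.Bundles using (Equivalence)
open import Level using (Level)
open import Relation.Binary.PropositionalEquality as ≡ using (_≡_)
open import Relation.Binary.Structures using (IsEquivalence)
open import Relation.Nullary using (yes; no)
open import Relation.Nullary.Decidable using (dec-true; dec-false)
open import Defs

allSubsets-complete : ∀ n (a : Subset n) → a ∈ allSubsets n
allSubsets-complete _ [] = here ≡.refl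
allSubsets-complete (suc n) (true ∷ a) = ∈-++⁺ˡ (∈-map⁺ (true ∷_) (allSubsets-complete n a))
allSubsets-complete (suc n) (false ∷ a) =
  ∈-++⁺ʳ (map (true ∷_) (allSubsets n)) (∈-map⁺ (false ∷_) (allSubsets-complete n a))

=ˢ-refl : ∀ {n} (a : Subset n) → a =ˢ a ≡ true
=ˢ-refl a = dec-true (≡-dec Bool._≟_ a a) ≡.refl

=ˢ-sym : ∀ {n} (a b : Subset n) → a =ˢ b ≡ b =ˢ a
=ˢ-sym a b with ≡-dec Bool._≟_ a b
... | yes ≡.refl = ≡.sym (=ˢ-refl a)
... | no a≢b = ≡.sym (dec-false (≡-dec Bool._≟_ b a) (λ b≡a → a≢b (≡.sym b≡a)))

any-=ˢ-allSubsets : ∀ {n} (a : Subset n) → any (a =ˢ_) (allSubsets n) ≡ true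
any-=ˢ-allSubsets {n} a = Equivalence.to Bool.T-≡
  (any⁺ (a =ˢ_) (Any.map (λ { ≡.refl → Equivalence.from Bool.T-≡ (=ˢ-refl a) }) (allSubsets-complete n a)))

module ListSums {c ℓ} (R : CommutativeSemiring c ℓ) where
  open CommutativeSemiring R renaming (Carrier to A)

  [_]_ : Bool → A → A
  [ p ] x = if p then x else 0#

  private variable
    i : Level
    X Y : Set i

  ∑ : List X → (X → A) → A
  ∑ L f = foldr _+_ 0# (map f L)

  ∑-cong : ∀ (L : List X) {f g : X → A} → (∀ y → f y ≈ g y) → ∑ L f ≈ ∑ L g
  ∑-cong [] f≈g = refl
  ∑-cong (y ∷ L) f≈g = +-cong (f≈g y) (∑-cong L f≈g)

  ∑-zero : ∀ (L : List X) → ∑ L (λ _ → 0#) ≈ 0#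
  ∑-zero [] = refl
  ∑-zero (y ∷ L) = trans (+-identityˡ _) (∑-zero L)

  ∑-distrib-+ : ∀ (L : List X) (f g : X → A) → ∑ L (λ y → f y + g y) ≈ ∑ L f + ∑ L g
  ∑-distrib-+ [] f g = sym (+-identityˡ 0#)
  ∑-distrib-+ (y ∷ L) f g = trans (+-congˡ (∑-distrib-+ L f g)) (interchange _ _ _ _)
    where open import Algebra.Properties.CommutativeSemigroup +-commutativeSemigroup using (interchange)

  *-distribˡ-∑ : ∀ (L : List X) (a : A) (f : X → A) → a * ∑ L f ≈ ∑ L (λ y → a * f y)
  *-distribˡ-∑ [] a f = zeroʳ a
  *-distribˡ-∑ (y ∷ L) a f = trans (distribˡ a _ _) (+-congˡ (*-distribˡ-∑ L a f))

  *-distribʳ-∑ : ∀ (L : List X) (a : A) (f : X → A) → ∑ L f * a ≈ ∑ L (λ y → f y * a)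
  *-distribʳ-∑ [] a f = zeroˡ a
  *-distribʳ-∑ (y ∷ L) a f = trans (distribʳ a _ _) (+-congˡ (*-distribʳ-∑ L a f))

  ∑-comm : (L : List X) (M : List Y) (f : X → Y → A) →
           ∑ L (λ a → ∑ M (f a)) ≈ ∑ M (λ b → ∑ L (λ a → f a b))
  ∑-comm [] M f = sym (∑-zero M)
  ∑-comm (a ∷ L) M f =
    trans (+-congˡ (∑-comm L M f)) (sym (∑-distrib-+ M (f a) (λ b → ∑ L (λ a → f a b))))

  ∑-factorˡ : ∀ (L : List X) (a : A) (f g : X → A) →
              ∑ L (λ y → (a * f y) * g y) ≈ a * ∑ L (λ y → f y * g y)
  ∑-factorˡ L a f g = trans (∑-cong L (λ y → *-assoc a (f y) (g y))) (sym (*-distribˡ-∑ L a _))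

  guard-cong : ∀ p {x y} → x ≈ y → [ p ] x ≈ [ p ] y
  guard-cong true x≈y = x≈y
  guard-cong false x≈y = refl

  guard-zero : ∀ p → [ p ] 0# ≈ 0#
  guard-zero true = refl
  guard-zero false = refl

  guard-+ : ∀ p x y → [ p ] (x + y) ≈ [ p ] x + [ p ] y
  guard-+ true x y = refl
  guard-+ false x y = sym (+-identityʳ 0#)

  guard-*ˡ : ∀ p x y → x * [ p ] y ≈ [ p ] (x * y)
  guard-*ˡ true x y = refl
  guard-*ˡ false x y = zeroʳ x

  guard-*ʳ : ∀ p x y → [ p ] x * y ≈ [ p ] (x * y)
  guard-*ʳ true x y = refl
  guard-*ʳ false x y = zeroˡ y

  guard-swap : ∀ p q x → [ p ] [ q ] x ≡ [ q ] [ p ] x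
  guard-swap true q x = ≡.refl
  guard-swap false true x = ≡.refl
  guard-swap false false x = ≡.refl

  guard-∧ : ∀ p q x → [ p ∧ q ] x ≡ [ p ] [ q ] x
  guard-∧ true q x = ≡.refl
  guard-∧ false q x = ≡.refl

  module _ (+-idem : Idempotent _≈_ _+_) where

    guard-∨ : ∀ p q x → [ p ] x + [ q ] x ≈ [ p ∨ q ] x
    guard-∨ true true x = +-idem x
    guard-∨ true false x = +-identityʳ x
    guard-∨ false q x = +-identityˡ _

    ∑-guard : (p : X → Bool) (a : A) (L : List X) →
              ∑ L (λ y → [ p y ] a) ≈ [ any p L ] a
    ∑-guard p a [] = refl
    ∑-guard p a (y ∷ L) = trans (+-congˡ (∑-guard p a L)) (guard-∨ (p y) (any p L) a)

module Laws {c ℓ} (K : CommutativeSemiring c ℓ)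
  (+-idem : Idempotent (CommutativeSemiring._≈_ K) (CommutativeSemiring._+_ K))
  (n : ℕ) (k : Fin n → CommutativeSemiring.Carrier K) where

  open CommutativeSemiring K renaming (Carrier to A)
  open WAI K n k
  open ListSums K
  open import Relation.Binary.Reasoning.Setoid setoid

  subsets : List (Subset n)
  subsets = allSubsets n

  infix 4 _≐_

  _≐_ : (Subset n → A) → (Subset n → A) → Set ℓ
  f ≐ g = ∀ a → f a ≈ g a

  -- Idempotence lets us avoid proving that allSubsets has no repetitions.
  ∑-δ : ∀ a (g : Subset n → A) → ∑ subsets (λ b → [ a =ˢ b ] g b) ≈ g a
  ∑-δ a g = begin
    ∑ subsets (λ b → [ a =ˢ b ] g b)   ≈⟨ ∑-cong subsets (λ b → reflexive (guard-at b)) ⟩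
    ∑ subsets (λ b → [ a =ˢ b ] g a)   ≈⟨ ∑-guard +-idem (a =ˢ_) (g a) subsets ⟩
    [ any (a =ˢ_) subsets ] g a        ≡⟨ ≡.cong ([_] g a) (any-=ˢ-allSubsets a) ⟩
    g a                                ∎
    where
    guard-at : ∀ b → [ a =ˢ b ] g b ≡ [ a =ˢ b ] g a
    guard-at b with ≡-dec Bool._≟_ a b
    ... | yes ≡.refl = ≡.refl
    ... | no _ = ≡.refl

  sumγ-cong : ∀ γ {f g} → f ≐ g → sumγ γ f ≈ sumγ γ g
  sumγ-cong γ f≈g = ∑-cong subsets (λ a → guard-cong (γ a) (f≈g a))

  sumγ-singleton : ∀ a (f : Subset n → A) → sumγ ⟪ a ⟫ f ≈ f a
  sumγ-singleton = ∑-δ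

  guard-anyγ : ∀ γ (q : Subset n → Bool) x → [ anyγ γ q ] x ≈ sumγ γ (λ a → [ q a ] x)
  guard-anyγ γ q x = begin
    [ anyγ γ q ] x                         ≡⟨ ≡.cong ([_] x) (≡.sym (foldr-map _∨_ γ∧q false subsets)) ⟩
    [ any γ∧q subsets ] x                  ≈⟨ sym (∑-guard +-idem γ∧q x subsets) ⟩
    ∑ subsets (λ a → [ γ∧q a ] x)          ≈⟨ ∑-cong subsets (λ a → reflexive (guard-∧ (γ a) (q a) x)) ⟩
    sumγ γ (λ a → [ q a ] x)               ∎
    where
    γ∧q : Subset n → Bool
    γ∧q a = γ a ∧ q a

  infixl 7 _⋆_

  _⋆_ : (Subset n → A) → (Subset n → A) → Subset n → A
  (f ⋆ g) a = sumSplit a (λ b c → f b * g c)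

  ε : Subset n → A
  ε b = [ b =ˢ ∅ ] 1#

  ⋆-cong : ∀ {f f′ g g′} → f ≐ f′ → g ≐ g′ → f ⋆ g ≐ f′ ⋆ g′
  ⋆-cong f≐f′ g≐g′ a = ∑-cong subsets λ b → ∑-cong subsets λ c →
    guard-cong ((b ∪ c) =ˢ a) (*-cong (f≐f′ b) (g≐g′ c))

  ⋆-comm : ∀ f g → f ⋆ g ≐ g ⋆ f
  ⋆-comm f g a = trans (∑-comm subsets subsets _) (∑-cong subsets λ c → ∑-cong subsets λ b →
    trans (reflexive (≡.cong (λ u → [ u =ˢ a ] (f b * g c)) (∪-comm b c)))
          (guard-cong ((c ∪ b) =ˢ a) (*-comm (f b) (g c))))

  ⋆-distribʳ : ∀ f g h → (λ b → g b + h b) ⋆ f ≐ (λ a → (g ⋆ f) a + (h ⋆ f) a)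
  ⋆-distribʳ f g h a = trans (∑-cong subsets λ b → trans (∑-cong subsets λ c →
      trans (guard-cong ((b ∪ c) =ˢ a) (distribʳ (f c) (g b) (h b))) (guard-+ ((b ∪ c) =ˢ a) _ _))
      (∑-distrib-+ subsets _ _)) (∑-distrib-+ subsets _ _)

  ⋆-zeroˡ : ∀ g → (λ _ → 0#) ⋆ g ≐ (λ _ → 0#)
  ⋆-zeroˡ g a = trans (∑-cong subsets λ b → trans (∑-cong subsets λ c →
      trans (guard-cong ((b ∪ c) =ˢ a) (zeroˡ (g c))) (guard-zero ((b ∪ c) =ˢ a)))
      (∑-zero subsets)) (∑-zero subsets)

  ∑-⋆ : ∀ f g (w : Subset n → A) →
        ∑ subsets (λ c → (f ⋆ g) c * w c) ≈ ∑ subsets (λ b → ∑ subsets (λ d → (f b * g d) * w (b ∪ d)))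
  ∑-⋆ f g w = begin
    ∑ subsets (λ c → (f ⋆ g) c * w c)
      ≈⟨ ∑-cong subsets expand ⟩
    ∑ subsets (λ c → ∑ subsets λ b → ∑ subsets λ d → [ (b ∪ d) =ˢ c ] ((f b * g d) * w c))
      ≈⟨ ∑-comm subsets subsets _ ⟩
    ∑ subsets (λ b → ∑ subsets λ c → ∑ subsets λ d → [ (b ∪ d) =ˢ c ] ((f b * g d) * w c))
      ≈⟨ ∑-cong subsets (λ b → ∑-comm subsets subsets _) ⟩
    ∑ subsets (λ b → ∑ subsets λ d → ∑ subsets λ c → [ (b ∪ d) =ˢ c ] ((f b * g d) * w c))
      ≈⟨ ∑-cong subsets (λ b → ∑-cong subsets λ d → ∑-δ (b ∪ d) (λ c → (f b * g d) * w c)) ⟩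
    ∑ subsets (λ b → ∑ subsets (λ d → (f b * g d) * w (b ∪ d))) ∎
    where
    expand : ∀ c → (f ⋆ g) c * w c
                 ≈ ∑ subsets λ b → ∑ subsets λ d → [ (b ∪ d) =ˢ c ] ((f b * g d) * w c)
    expand c = trans (*-distribʳ-∑ subsets (w c) _) (∑-cong subsets λ b →
      trans (*-distribʳ-∑ subsets (w c) _) (∑-cong subsets λ d → guard-*ʳ ((b ∪ d) =ˢ c) _ _))

  ≐-from-pairing : ∀ {u v} → (∀ w → ∑ subsets (λ c → u c * w c) ≈ ∑ subsets (λ c → v c * w c)) →
                   u ≐ v
  ≐-from-pairing {u} {v} pair a = begin
    u a                                   ≈⟨ sym (pairing-δ u) ⟩
    ∑ subsets (λ c → u c * [ a =ˢ c ] 1#) ≈⟨ pair (λ c → [ a =ˢ c ] 1#) ⟩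
    ∑ subsets (λ c → v c * [ a =ˢ c ] 1#) ≈⟨ pairing-δ v ⟩
    v a                                   ∎
    where
    pairing-δ : ∀ u → ∑ subsets (λ c → u c * [ a =ˢ c ] 1#) ≈ u a
    pairing-δ u = trans (∑-cong subsets λ c → trans (guard-*ˡ (a =ˢ c) (u c) 1#)
                                                    (guard-cong (a =ˢ c) (*-identityʳ (u c))))
                        (∑-δ a u)

  ⋆-identityˡ : ∀ g → ε ⋆ g ≐ g
  ⋆-identityˡ g = ≐-from-pairing λ w → begin
    ∑ subsets (λ c → (ε ⋆ g) c * w c)
      ≈⟨ ∑-⋆ ε g w ⟩
    ∑ subsets (λ b → ∑ subsets (λ d → (ε b * g d) * w (b ∪ d)))
      ≈⟨ ∑-cong subsets (λ b → trans (∑-factorˡ subsets (ε b) g (λ d → w (b ∪ d))) (ε-* b _)) ⟩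
    ∑ subsets (λ b → [ ∅ =ˢ b ] ∑ subsets (λ d → g d * w (b ∪ d)))
      ≈⟨ ∑-δ ∅ _ ⟩
    ∑ subsets (λ d → g d * w (∅ ∪ d))
      ≈⟨ ∑-cong subsets (λ d → reflexive (≡.cong (λ c → g d * w c) (∪-identityˡ d))) ⟩
    ∑ subsets (λ c → g c * w c) ∎
    where
    ε-* : ∀ b x → ε b * x ≈ [ ∅ =ˢ b ] x
    ε-* b x = trans (guard-*ʳ (b =ˢ ∅) 1# x)
                    (trans (guard-cong (b =ˢ ∅) (*-identityˡ x)) (reflexive (≡.cong ([_] x) (=ˢ-sym b ∅))))

  ⋆-assoc : ∀ f g h → (f ⋆ g) ⋆ h ≐ f ⋆ (g ⋆ h)
  ⋆-assoc f g h = ≐-from-pairing λ w → trans (pairingˡ w) (sym (pairingʳ w))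
    where
    triple : (Subset n → A) → A
    triple w = ∑ subsets λ e → ∑ subsets λ t → f e * ∑ subsets λ d → g t * (h d * w (e ∪ (t ∪ d)))

    pairingˡ : ∀ w → ∑ subsets (λ c → ((f ⋆ g) ⋆ h) c * w c) ≈ triple w
    pairingˡ w = begin
      ∑ subsets (λ c → ((f ⋆ g) ⋆ h) c * w c)
        ≈⟨ ∑-⋆ (f ⋆ g) h w ⟩
      ∑ subsets (λ b → ∑ subsets λ d → ((f ⋆ g) b * h d) * w (b ∪ d))
        ≈⟨ ∑-cong subsets (λ b → ∑-factorˡ subsets ((f ⋆ g) b) h (λ d → w (b ∪ d))) ⟩
      ∑ subsets (λ b → (f ⋆ g) b * ∑ subsets λ d → h d * w (b ∪ d))
        ≈⟨ ∑-⋆ f g (λ b → ∑ subsets λ d → h d * w (b ∪ d)) ⟩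
      ∑ subsets (λ e → ∑ subsets λ t → (f e * g t) * ∑ subsets λ d → h d * w ((e ∪ t) ∪ d))
        ≈⟨ ∑-cong subsets (λ e → ∑-cong subsets λ t → regroup e t) ⟩
      triple w ∎
      where
      regroup : ∀ e t → (f e * g t) * ∑ subsets (λ d → h d * w ((e ∪ t) ∪ d))
                      ≈ f e * ∑ subsets (λ d → g t * (h d * w (e ∪ (t ∪ d))))
      regroup e t = trans (*-assoc (f e) (g t) _) (*-congˡ (trans (*-distribˡ-∑ subsets (g t) _)
        (∑-cong subsets λ d → *-congˡ (*-congˡ (reflexive (≡.cong w (∪-assoc e t d)))))))

    pairingʳ : ∀ w → ∑ subsets (λ c → (f ⋆ (g ⋆ h)) c * w c) ≈ triple w
    pairingʳ w = begin
      ∑ subsets (λ c → (f ⋆ (g ⋆ h)) c * w c)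
        ≈⟨ ∑-⋆ f (g ⋆ h) w ⟩
      ∑ subsets (λ e → ∑ subsets λ c → (f e * (g ⋆ h) c) * w (e ∪ c))
        ≈⟨ ∑-cong subsets (λ e → ∑-factorˡ subsets (f e) (g ⋆ h) (λ c → w (e ∪ c))) ⟩
      ∑ subsets (λ e → f e * ∑ subsets λ c → (g ⋆ h) c * w (e ∪ c))
        ≈⟨ ∑-cong subsets (λ e → *-congˡ (∑-⋆ g h (λ c → w (e ∪ c)))) ⟩
      ∑ subsets (λ e → f e * ∑ subsets λ t → ∑ subsets λ d → (g t * h d) * w (e ∪ (t ∪ d)))
        ≈⟨ ∑-cong subsets (λ e → trans (*-distribˡ-∑ subsets (f e) _)
             (∑-cong subsets λ t → *-congˡ (∑-cong subsets λ d → *-assoc (g t) (h d) _))) ⟩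
      triple w ∎

  profile : Term n → Subset n → A
  profile z a = ⟦ z ⟧ ⟪ a ⟫

  profile-⊕ : ∀ x y → profile (x ⊕ y) ≐ λ a → profile x a + profile y a
  profile-⊕ x y a = sumγ-singleton a _

  profile-⊗ : ∀ x y → profile (x ⊗ y) ≐ profile x ⋆ profile y
  profile-⊗ x y a = sumγ-singleton a _

  profile-port : ∀ p → profile (port p) ≐ λ a → [ contains p a ] k p
  profile-port p a = trans (guard-anyγ ⟪ a ⟫ (contains p) (k p)) (sumγ-singleton a _)

  ⟦⟧≈sumγ-profile : ∀ z γ → ⟦ z ⟧ γ ≈ sumγ γ (profile z)
  ⟦⟧≈sumγ-profile 𝟘 γ = sym (trans (∑-cong subsets λ a → guard-zero (γ a)) (∑-zero subsets))
  ⟦⟧≈sumγ-profile 𝟙 γ = sym (begin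
    ∑ subsets (λ a → [ γ a ] [ a =ˢ ∅ ] 1#)
      ≈⟨ ∑-cong subsets (λ a → reflexive (≡.trans (guard-swap (γ a) (a =ˢ ∅) 1#)
                                                 (≡.cong ([_] [ γ a ] 1#) (=ˢ-sym a ∅)))) ⟩
    ∑ subsets (λ a → [ ∅ =ˢ a ] [ γ a ] 1#)
      ≈⟨ ∑-δ ∅ (λ a → [ γ a ] 1#) ⟩
    [ γ ∅ ] 1# ∎)
  ⟦⟧≈sumγ-profile (port p) γ =
    trans (guard-anyγ γ (contains p) (k p)) (sumγ-cong γ λ a → sym (profile-port p a))
  ⟦⟧≈sumγ-profile (x ⊕ y) γ = sumγ-cong γ λ a → sym (profile-⊕ x y a)
  ⟦⟧≈sumγ-profile (x ⊗ y) γ = sumγ-cong γ λ a → sym (profile-⊗ x y a)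

  ≋-from-profile : ∀ x y → profile x ≐ profile y → x ≋ y
  ≋-from-profile x y px≐py γ =
    trans (⟦⟧≈sumγ-profile x γ) (trans (sumγ-cong γ px≐py) (sym (⟦⟧≈sumγ-profile y γ)))

  open import Algebra.Definitions _≋_
    using (Congruent₂; Associative; Commutative; LeftIdentity; LeftZero; _DistributesOverʳ_)

  ≋-isEquivalence : IsEquivalence _≋_
  ≋-isEquivalence = record
    { refl = λ γ → refl ; sym = λ x≋y γ → sym (x≋y γ) ; trans = λ x≋y y≋z γ → trans (x≋y γ) (y≋z γ) }

  ⊕-cong : Congruent₂ _⊕_
  ⊕-cong x≋x′ y≋y′ γ = sumγ-cong γ λ a → +-cong (x≋x′ ⟪ a ⟫) (y≋y′ ⟪ a ⟫)

  ⊕-assoc : Associative _⊕_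
  ⊕-assoc x y z γ = sumγ-cong γ λ a →
    trans (+-congʳ (profile-⊕ x y a)) (trans (+-assoc _ _ _) (+-congˡ (sym (profile-⊕ y z a))))

  ⊕-comm : Commutative _⊕_
  ⊕-comm x y γ = sumγ-cong γ λ a → +-comm _ _

  ⊕-identityˡ : LeftIdentity 𝟘 _⊕_
  ⊕-identityˡ x = ≋-from-profile (𝟘 ⊕ x) x λ a → trans (profile-⊕ 𝟘 x a) (+-identityˡ _)

  ⊕-idem : Idempotent _≋_ _⊕_
  ⊕-idem x = ≋-from-profile (x ⊕ x) x λ a → trans (profile-⊕ x x a) (+-idem _)

  ⊗-cong : Congruent₂ _⊗_
  ⊗-cong x≋x′ y≋y′ γ = sumγ-cong γ (⋆-cong (λ a → x≋x′ ⟪ a ⟫) (λ a → y≋y′ ⟪ a ⟫))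

  ⊗-assoc : Associative _⊗_
  ⊗-assoc x y z γ = sumγ-cong γ λ a →
    trans (⋆-cong (profile-⊗ x y) (λ _ → refl) a)
          (trans (⋆-assoc _ _ _ a) (⋆-cong (λ _ → refl) (λ b → sym (profile-⊗ y z b)) a))

  ⊗-comm : Commutative _⊗_
  ⊗-comm x y γ = sumγ-cong γ (⋆-comm _ _)

  ⊗-identityˡ : LeftIdentity 𝟙 _⊗_
  ⊗-identityˡ x = ≋-from-profile (𝟙 ⊗ x) x λ a → trans (profile-⊗ 𝟙 x a) (⋆-identityˡ _ a)

  ⊗-distribʳ : _⊗_ DistributesOverʳ _⊕_
  ⊗-distribʳ x y z γ = sumγ-cong γ λ a →
    trans (⋆-cong (profile-⊕ y z) (λ _ → refl) a)
          (trans (⋆-distribʳ _ _ _ a) (sym (+-cong (profile-⊗ y x a) (profile-⊗ z x a))))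

  ⊗-zeroˡ : LeftZero 𝟘 _⊗_
  ⊗-zeroˡ x = ≋-from-profile (𝟘 ⊗ x) 𝟘 λ a → trans (profile-⊗ 𝟘 x a) (⋆-zeroˡ _ a)

  -- _≋_ does not determine the terms it relates, so the implicit arguments of the
  -- congruences are passed on explicitly.
  ⊕-isMagma : IsMagma _≋_ _⊕_
  ⊕-isMagma = record { isEquivalence = ≋-isEquivalence ; ∙-cong = λ {x y u v} → ⊕-cong {x} {y} {u} {v} }

  ⊗-isMagma : IsMagma _≋_ _⊗_
  ⊗-isMagma = record { isEquivalence = ≋-isEquivalence ; ∙-cong = λ {x y u v} → ⊗-cong {x} {y} {u} {v} }

  ≋-isCommutativeSemiring : IsCommutativeSemiring _≋_ _⊕_ _⊗_ 𝟘 𝟙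
  ≋-isCommutativeSemiring = isCommutativeSemiringˡ record
    { +-isCommutativeMonoid = isCommutativeMonoidˡ record
      { isSemigroup = record { isMagma = ⊕-isMagma ; assoc = ⊕-assoc }
      ; identityˡ = ⊕-identityˡ
      ; comm = ⊕-comm
      }
    ; *-isCommutativeMonoid = isCommutativeMonoidˡ record
      { isSemigroup = record { isMagma = ⊗-isMagma ; assoc = ⊗-assoc }
      ; identityˡ = ⊗-identityˡ
      ; comm = ⊗-comm
      }
    ; distribʳ = ⊗-distribʳ
    ; zeroˡ = ⊗-zeroˡ
    }

corollary1 : ∀ {c ℓ} (K : CommutativeSemiring c ℓ)
    → Idempotent (CommutativeSemiring._≈_ K) (CommutativeSemiring._+_ K)
    → (m : ℕ) (k : Fin (suc m) → CommutativeSemiring.Carrier K)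
    → IsCommutativeSemiring (WAI._≋_ K (suc m) k) _⊕_ _⊗_ 𝟘 𝟙
    × Idempotent (WAI._≋_ K (suc m) k) _⊕_
corollary1 K +-idem m k = ≋-isCommutativeSemiring , ⊕-idem
  where open Laws K +-idem (suc m) k
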